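{- Let $G$ be a finite simple undirected graph, $C$ a cycle of $G$, $\mathcal{M}$ an MCB, and $L=\max\{|C'|: C'\in\mathcal{E}_{\mathcal{M}}(C)\}$. Then: (1) $L\le|C|$; (2) $L=|C|$ if and only if $C\in\mathcal{C}_{\mathcal{R}}$. Furthermore, if $C\in\mathcal{C}_{\mathcal{R}}$, then for any $C'\in\mathcal{E}_{\mathcal{M}}(C)$ with $|C'|=|C|$, the set $(\mathcal{M}\setminus\{C'\})\cup\{C\}$ is an MCB.
   Context: Let $G=(V,E)$ be a finite simple undirected graph. A cycle is a set $C\subseteq E$ such that every vertex of $G$ has even degree in the subgraph with edge set $C$; $|C|$ denotes the number of edges. The cycles form a vector space over $GF(2)$ under symmetric difference $\oplus$. A minimum cycle basis (MCB) is a basis $\mathcal{M}$ of this space minimizing $\sum_{B\in\mathcal{M}}|B|$. The set of relevant cycles $\mathcal{C}_{\mathcal{R}}$ is the union of all MCBs. For a basis $\mathcal{B}$ and a cycle $C$, $\mathcal{E}_{\mathcal{B}}(C)$ denotes the unique subset of $\mathcal{B}$ whose $\oplus$-sum is $C$ (for $C\neq\emptyset$ this set is nonempty). -}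

module Defs where

open import Data.Nat using (ℕ; zero; suc; _+_; _≤_; _⊔_)
open import Data.Nat.Divisibility using (_∣_)
open import Data.Bool using (Bool; true; false; if_then_else_; _xor_; _∨_; _∧_)
open import Data.Fin using (Fin; zero; suc)
import Data.Fin as F
open import Data.Fin.Subset using (Subset; ∣_∣; _∈_) renaming (⊥ to ∅)
open import Data.Vec using (Vec; []; _∷_; zipWith; lookup; replicate)
open import Data.Sum using (_⊎_)
open import Data.Product using (Σ; _×_; _,_; ∃; proj₁; proj₂)
open import Relation.Binary.PropositionalEquality using (_≡_; _≢_)
open import Relation.Nullary using (yes; no; ¬_; does)

record Graph : Set where
  field
    n : ℕ
    m : ℕ
    end₁ : Fin m → Fin n
    end₂ : Fin m → Fin n
    loopless : ∀ e → end₁ e ≢ end₂ e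
    noParallel : ∀ e f →
      ((end₁ e ≡ end₁ f × end₂ e ≡ end₂ f) ⊎
       (end₁ e ≡ end₂ f × end₂ e ≡ end₁ f)) → e ≡ f
open Graph public


EdgeSet : Graph → Set
EdgeSet G = Subset (m G)

incident : (G : Graph) → Fin (n G) → Fin (m G) → Bool
incident G v e = does (end₁ G e F.≟ v) ∨ does (end₂ G e F.≟ v)

countFrom : ∀ {k} → Vec Bool k → (Fin k → Bool) → ℕ
countFrom [] f = 0
countFrom (b ∷ bs) f = (if b ∧ f zero then 1 else 0) + countFrom bs (λ i → f (suc i))

degree : (G : Graph) → EdgeSet G → Fin (n G) → ℕ
degree G C v = countFrom C (incident G v)

IsCycle : (G : Graph) → EdgeSet G → Set
IsCycle G C = ∀ v → 2 ∣ degree G C v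

_⊕_ : ∀ {m} → Subset m → Subset m → Subset m
_⊕_ = zipWith _xor_

sumSel : ∀ {m k} → Subset k → (Fin k → Subset m) → Subset m
sumSel [] B = ∅
sumSel (b ∷ s) B = (if b then B zero else ∅) ⊕ sumSel s (λ i → B (suc i))

weight : ∀ {m k} → (Fin k → Subset m) → ℕ
weight {k = zero} B = 0
weight {k = suc k} B = ∣ B zero ∣ + weight (λ i → B (suc i))

record IsBasis (G : Graph) {k : ℕ} (B : Fin k → EdgeSet G) : Set where
  field
    cycles : ∀ i → IsCycle G (B i)
    independent : ∀ (s : Subset k) → sumSel s B ≡ ∅ → s ≡ ∅
    spanning : ∀ (C : EdgeSet G) → IsCycle G C → ∃ λ (s : Subset k) → sumSel s B ≡ C

IsMCB : (G : Graph) {k : ℕ} → (Fin k → EdgeSet G) → Set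
IsMCB G {k} B = IsBasis G B ×
  (∀ (k' : ℕ) (B' : Fin k' → EdgeSet G) → IsBasis G B' → weight B ≤ weight B')

IsRelevant : (G : Graph) → EdgeSet G → Set
IsRelevant G C = Σ ℕ λ k → Σ (Fin k → EdgeSet G) λ B → IsMCB G B × ∃ λ i → B i ≡ C

maxSel : ∀ {m k} → Subset k → (Fin k → Subset m) → ℕ
maxSel [] B = 0
maxSel (b ∷ s) B = (if b then ∣ B zero ∣ else 0) ⊔ maxSel s (λ i → B (suc i))

-- (B \ {B i}) ∪ {C}: replace the i-th member by C
replace : ∀ {m k} → (Fin k → Subset m) → Fin k → Subset m → (Fin k → Subset m)
replace B i C j with j F.≟ i
... | yes _ = C
... | no _ = B j

module Submission where

-- Write C = Σ_{j ∈ E} M j. For i ∈ E, replacing M i by C yields again a basis: in coordinates the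
-- change is the transvection s ↦ s + s_i (e_i + E) over GF(2), an involution because the i-th
-- entry of e_i + E vanishes. Comparing weights with the minimum basis M gives |M i| ≤ |C|, and in
-- case of equality the new basis is an MCB containing C. Conversely, if C is the member M' i' of an
-- MCB M', expanding every M j (j ∈ E) in M' must use M' i' for some j ∈ E, and the same exchange
-- inside M' gives |C| = |M' i'| ≤ |M j|.

open import Defs
open import Algebra.Bundles using (AbelianGroup)
open import Algebra.Structures using (IsAbelianGroup)
import Algebra.Properties.AbelianGroup as AbelianGroupProperties
import Algebra.Properties.CommutativeSemigroup as CommutativeSemigroupProperties
open import Data.Bool using (Bool; true; false; _xor_; if_then_else_)
open import Data.Bool.Properties using (xor-assoc; xor-comm; xor-identityˡ; xor-identityʳ; xor-same)
open import Data.Empty using (⊥-elim)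
open import Data.Fin using (Fin; zero; suc; punchIn)
import Data.Fin as F
open import Data.Fin.Properties using (punchInᵢ≢i; suc-injective)
open import Data.Fin.Subset using (Subset; ∣_∣; _∈_; ⁅_⁆; inside; outside) renaming (⊥ to ∅)
open import Data.Fin.Subset.Properties using (x∈⁅x⁆; ∉⊥)
open import Data.Nat using (ℕ; zero; suc; _≤_; _+_; z≤n)
open import Data.Nat.Properties
  using ( ≤-trans; ≤-antisym; ≤-reflexive; +-cancelˡ-≤; +-cancelʳ-≡; +-monoˡ-≤
        ; ⊔-sel; ⊔-lub; m≤m⊔n; m≤n⊔m; +-commutativeSemigroup; module ≤-Reasoning)
open import Data.Product using (_×_; _,_; ∃; proj₁; proj₂)
import Data.Sum as Sum
open Sum using (_⊎_; inj₁; inj₂)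
open import Data.Vec using ([]; _∷_; lookup; here; there)
open import Data.Vec.Properties
  using ( zipWith-assoc; zipWith-comm; zipWith-identityˡ; zipWith-identityʳ
        ; lookup-zipWith; lookup-replicate; []=⇒lookup)
open import Function using (id; _∘_)
open import Function.Bundles using (_⇔_; mk⇔)
open import Relation.Binary.PropositionalEquality
import Relation.Binary.PropositionalEquality.Algebra as ≡-Algebra
open import Relation.Nullary using (yes; no)

⊕-isAbelianGroup : ∀ {m} → IsAbelianGroup _≡_ (_⊕_ {m}) ∅ id
⊕-isAbelianGroup = record
  { isGroup = record
    { isMonoid = record
      { isSemigroup = record { isMagma = ≡-Algebra.isMagma _⊕_ ; assoc = zipWith-assoc xor-assoc }
      ; identity = zipWith-identityˡ xor-identityˡ , zipWith-identityʳ xor-identityʳ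
      }
    ; inverse = ⊕-self , ⊕-self
    ; ⁻¹-cong = cong id
    }
  ; comm = zipWith-comm xor-comm
  }
  where
  ⊕-self : ∀ {m} (x : Subset m) → x ⊕ x ≡ ∅
  ⊕-self [] = refl
  ⊕-self (b ∷ x) = cong₂ _∷_ (xor-same b) (⊕-self x)

⊕-abelianGroup : ℕ → AbelianGroup _ _
⊕-abelianGroup m = record { isAbelianGroup = ⊕-isAbelianGroup {m} }

module ⊕ {m : ℕ} where
  open AbelianGroup (⊕-abelianGroup m) public
    using (identityˡ; identityʳ; inverseʳ)
  open AbelianGroupProperties (⊕-abelianGroup m) public
    using ()
    renaming ( x∙y⁻¹≈ε⇒x≈y to x⊕y≡∅⇒x≡y
             ; \\-leftDividesˡ to x⊕[x⊕y]≡y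
             ; //-rightDividesʳ to [y⊕x]⊕x≡y)
  open CommutativeSemigroupProperties (AbelianGroup.commutativeSemigroup (⊕-abelianGroup m)) public
    using (interchange)

infixr 30 _·_

_·_ : ∀ {m} → Bool → Subset m → Subset m
b · x = if b then x else ∅

·-zeroʳ : ∀ {m} b → b · ∅ {m} ≡ ∅
·-zeroʳ true = refl
·-zeroʳ false = refl

·-distribʳ-xor : ∀ {m} a b (x : Subset m) → (a xor b) · x ≡ a · x ⊕ b · x
·-distribʳ-xor false b x = sym (⊕.identityˡ (b · x))
·-distribʳ-xor true false x = sym (⊕.identityʳ x)
·-distribʳ-xor true true x = sym (⊕.inverseʳ x)

·-distribˡ-⊕ : ∀ {m} b (x y : Subset m) → b · (x ⊕ y) ≡ b · x ⊕ b · y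
·-distribˡ-⊕ true x y = refl
·-distribˡ-⊕ false x y = sym (⊕.identityˡ ∅)

lookup-·-false : ∀ {m} b {x : Subset m} {i} → lookup x i ≡ false → lookup (b · x) i ≡ false
lookup-·-false true xᵢ≡false = xᵢ≡false
lookup-·-false false {i = i} _ = lookup-replicate i false

∈-⊕⁻ : ∀ {m} {i : Fin m} x y → i ∈ x ⊕ y → i ∈ x ⊎ i ∈ y
∈-⊕⁻ (true ∷ x) (false ∷ y) here = inj₁ here
∈-⊕⁻ (false ∷ x) (true ∷ y) here = inj₂ here
∈-⊕⁻ (_ ∷ x) (_ ∷ y) (there i∈x⊕y) = Sum.map there there (∈-⊕⁻ x y i∈x⊕y)

∣p∣≡0⇒p≡∅ : ∀ {m} (p : Subset m) → ∣ p ∣ ≡ 0 → p ≡ ∅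
∣p∣≡0⇒p≡∅ [] _ = refl
∣p∣≡0⇒p≡∅ (outside ∷ p) ∣p∣≡0 = cong (outside ∷_) (∣p∣≡0⇒p≡∅ p ∣p∣≡0)
∣p∣≡0⇒p≡∅ (inside ∷ p) ()

sumSel-∅ : ∀ {m k} (B : Fin k → Subset m) → sumSel ∅ B ≡ ∅
sumSel-∅ {k = zero} B = refl
sumSel-∅ {k = suc k} B = trans (⊕.identityˡ _) (sumSel-∅ (B ∘ suc))

sumSel-⊕ : ∀ {m k} (s t : Subset k) (B : Fin k → Subset m) →
           sumSel (s ⊕ t) B ≡ sumSel s B ⊕ sumSel t B
sumSel-⊕ [] [] B = sym (⊕.identityˡ ∅)
sumSel-⊕ (a ∷ s) (b ∷ t) B =
  trans (cong₂ _⊕_ (·-distribʳ-xor a b (B zero)) (sumSel-⊕ s t (B ∘ suc)))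
        (⊕.interchange _ _ _ _)

sumSel-· : ∀ {m k} b (s : Subset k) (B : Fin k → Subset m) → sumSel (b · s) B ≡ b · sumSel s B
sumSel-· true s B = refl
sumSel-· false s B = sumSel-∅ B

sumSel-⁅⁆ : ∀ {m k} (i : Fin k) (B : Fin k → Subset m) → sumSel ⁅ i ⁆ B ≡ B i
sumSel-⁅⁆ zero B = trans (cong (B zero ⊕_) (sumSel-∅ (B ∘ suc))) (⊕.identityʳ (B zero))
sumSel-⁅⁆ (suc i) B = trans (⊕.identityˡ _) (sumSel-⁅⁆ i (B ∘ suc))

sumSel-injective : ∀ {m k} {B : Fin k → Subset m} → (∀ s → sumSel s B ≡ ∅ → s ≡ ∅) →
                   ∀ {s t} → sumSel s B ≡ sumSel t B → s ≡ t
sumSel-injective {B = B} independent {s} {t} s↦x≡t↦x =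
  ⊕.x⊕y≡∅⇒x≡y s t (independent (s ⊕ t) s⊕t↦∅)
  where
  open ≡-Reasoning
  s⊕t↦∅ : sumSel (s ⊕ t) B ≡ ∅
  s⊕t↦∅ = begin
    sumSel (s ⊕ t) B          ≡⟨ sumSel-⊕ s t B ⟩
    sumSel s B ⊕ sumSel t B   ≡⟨ cong (_⊕ sumSel t B) s↦x≡t↦x ⟩
    sumSel t B ⊕ sumSel t B   ≡⟨ ⊕.inverseʳ (sumSel t B) ⟩
    ∅                         ∎

sumSel-cong : ∀ {m k} (s : Subset k) {B B' : Fin k → Subset m} → (∀ j → B j ≡ B' j) →
              sumSel s B ≡ sumSel s B'
sumSel-cong [] B≗B' = refl
sumSel-cong (b ∷ s) B≗B' = cong₂ (λ x y → b · x ⊕ y) (B≗B' zero) (sumSel-cong s (B≗B' ∘ suc))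

sumSel-⊕ʳ : ∀ {m k} (s : Subset k) (B D : Fin k → Subset m) →
            sumSel s (λ j → B j ⊕ D j) ≡ sumSel s B ⊕ sumSel s D
sumSel-⊕ʳ [] B D = sym (⊕.identityˡ ∅)
sumSel-⊕ʳ (b ∷ s) B D =
  trans (cong₂ _⊕_ (·-distribˡ-⊕ b (B zero) (D zero)) (sumSel-⊕ʳ s (B ∘ suc) (D ∘ suc)))
        (⊕.interchange _ _ _ _)

sumSel-zeroʳ : ∀ {m k} (s : Subset k) → sumSel s (λ _ → ∅ {m}) ≡ ∅
sumSel-zeroʳ [] = refl
sumSel-zeroʳ (b ∷ s) = trans (cong₂ _⊕_ (·-zeroʳ b) (sumSel-zeroʳ s)) (⊕.identityˡ ∅)

sumSel-supported : ∀ {m k} (s : Subset k) (i : Fin k) (D : Fin k → Subset m) →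
                   (∀ j → j ≢ i → D j ≡ ∅) → sumSel s D ≡ lookup s i · D i
sumSel-supported (b ∷ s) zero D D-off-i = begin
  b · D zero ⊕ sumSel s (D ∘ suc)   ≡⟨ cong (b · D zero ⊕_) tail≡∅ ⟩
  b · D zero ⊕ ∅                    ≡⟨ ⊕.identityʳ (b · D zero) ⟩
  b · D zero                        ∎
  where
  open ≡-Reasoning
  tail≡∅ : sumSel s (D ∘ suc) ≡ ∅
  tail≡∅ = trans (sumSel-cong s (λ j → D-off-i (suc j) λ ())) (sumSel-zeroʳ s)
sumSel-supported (b ∷ s) (suc i) D D-off-i = begin
  b · D zero ⊕ sumSel s (D ∘ suc)          ≡⟨ cong₂ _⊕_ (cong (b ·_) (D-off-i zero λ ())) tail ⟩
  b · ∅ ⊕ lookup s i · D (suc i)           ≡⟨ cong (_⊕ lookup s i · D (suc i)) (·-zeroʳ b) ⟩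
  ∅ ⊕ lookup s i · D (suc i)               ≡⟨ ⊕.identityˡ (lookup s i · D (suc i)) ⟩
  lookup s i · D (suc i)                   ∎
  where
  open ≡-Reasoning
  tail : sumSel s (D ∘ suc) ≡ lookup s i · D (suc i)
  tail = sumSel-supported s i (D ∘ suc) (λ j j≢i → D-off-i (suc j) (j≢i ∘ suc-injective))

sumSel-sumSel : ∀ {m k l} (E : Subset k) (T : Fin k → Subset l) (B : Fin l → Subset m) →
                sumSel E (λ j → sumSel (T j) B) ≡ sumSel (sumSel E T) B
sumSel-sumSel [] T B = sym (sumSel-∅ B)
sumSel-sumSel (b ∷ E) T B =
  trans (cong₂ _⊕_ (sym (sumSel-· b (T zero) B)) (sumSel-sumSel E (T ∘ suc) B))
        (sym (sumSel-⊕ (b · T zero) (sumSel E (T ∘ suc)) B))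

∈-sumSel⁻ : ∀ {k l} {i : Fin l} (E : Subset k) (T : Fin k → Subset l) →
            i ∈ sumSel E T → ∃ λ j → j ∈ E × i ∈ T j
∈-sumSel⁻ [] T i∈∅ = ⊥-elim (∉⊥ i∈∅)
∈-sumSel⁻ (true ∷ E) T i∈S with ∈-⊕⁻ (T zero) (sumSel E (T ∘ suc)) i∈S
... | inj₁ i∈T₀ = zero , here , i∈T₀
... | inj₂ i∈tail =
  let j , j∈E , i∈Tⱼ = ∈-sumSel⁻ E (T ∘ suc) i∈tail
  in suc j , there j∈E , i∈Tⱼ
∈-sumSel⁻ (false ∷ E) T i∈S =
  let j , j∈E , i∈Tⱼ = ∈-sumSel⁻ E (T ∘ suc) (subst (_ ∈_) (⊕.identityˡ _) i∈S)
  in suc j , there j∈E , i∈Tⱼ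

weight-cong : ∀ {m k} {B B' : Fin k → Subset m} → (∀ j → B j ≡ B' j) → weight B ≡ weight B'
weight-cong {k = zero} B≗B' = refl
weight-cong {k = suc k} B≗B' = cong₂ _+_ (cong ∣_∣ (B≗B' zero)) (weight-cong (B≗B' ∘ suc))

weight-punchIn : ∀ {m k} (i : Fin (suc k)) (B : Fin (suc k) → Subset m) →
                 weight B ≡ ∣ B i ∣ + weight (B ∘ punchIn i)
weight-punchIn zero B = refl
weight-punchIn {k = suc k} (suc i) B = begin
  ∣ B zero ∣ + weight (B ∘ suc)
    ≡⟨ cong (∣ B zero ∣ +_) (weight-punchIn i (B ∘ suc)) ⟩
  ∣ B zero ∣ + (∣ B (suc i) ∣ + weight (B ∘ suc ∘ punchIn i))
    ≡⟨ x∙yz≈y∙xz (∣ B zero ∣) (∣ B (suc i) ∣) _ ⟩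
  ∣ B (suc i) ∣ + (∣ B zero ∣ + weight (B ∘ suc ∘ punchIn i))
    ∎
  where
  open ≡-Reasoning
  open CommutativeSemigroupProperties +-commutativeSemigroup using (x∙yz≈y∙xz)

replace-≡ : ∀ {m k} (B : Fin k → Subset m) i C → replace B i C i ≡ C
replace-≡ B i C with i F.≟ i
... | yes _ = refl
... | no i≢i = ⊥-elim (i≢i refl)

replace-≢ : ∀ {m k} (B : Fin k → Subset m) i C {j} → j ≢ i → replace B i C j ≡ B j
replace-≢ B i C {j} j≢i with j F.≟ i
... | yes j≡i = ⊥-elim (j≢i j≡i)
... | no _ = refl

weight-replace : ∀ {m k} (B : Fin k → Subset m) i C →
                 weight (replace B i C) + ∣ B i ∣ ≡ weight B + ∣ C ∣
weight-replace {k = suc k} B i C = begin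
  weight B' + ∣ B i ∣
    ≡⟨ cong (_+ ∣ B i ∣) (weight-punchIn i B') ⟩
  (∣ B' i ∣ + weight (B' ∘ punchIn i)) + ∣ B i ∣
    ≡⟨ cong₂ (λ x y → (∣ x ∣ + y) + ∣ B i ∣) (replace-≡ B i C) B'≡B-off-i ⟩
  (∣ C ∣ + w) + ∣ B i ∣
    ≡⟨ xy∙z≈zy∙x (∣ C ∣) w (∣ B i ∣) ⟩
  (∣ B i ∣ + w) + ∣ C ∣
    ≡⟨ cong (_+ ∣ C ∣) (weight-punchIn i B) ⟨
  weight B + ∣ C ∣
    ∎
  where
  open ≡-Reasoning
  open CommutativeSemigroupProperties +-commutativeSemigroup using (xy∙z≈zy∙x)
  B' = replace B i C
  w = weight (B ∘ punchIn i)
  B'≡B-off-i : weight (B' ∘ punchIn i) ≡ w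
  B'≡B-off-i = weight-cong (λ j → replace-≢ B i C (punchInᵢ≢i i j))

sumSel-replace : ∀ {m k} (s : Subset k) i (B : Fin k → Subset m) C →
                 sumSel s (replace B i C) ≡ sumSel s B ⊕ lookup s i · (B i ⊕ C)
sumSel-replace s i B C = begin
  sumSel s B'
    ≡⟨ sumSel-cong s (λ j → sym (⊕.x⊕[x⊕y]≡y (B j) (B' j))) ⟩
  sumSel s (λ j → B j ⊕ (B j ⊕ B' j))
    ≡⟨ sumSel-⊕ʳ s B (λ j → B j ⊕ B' j) ⟩
  sumSel s B ⊕ sumSel s (λ j → B j ⊕ B' j)
    ≡⟨ cong (sumSel s B ⊕_) (sumSel-supported s i _ agree-off-i) ⟩
  sumSel s B ⊕ lookup s i · (B i ⊕ B' i)
    ≡⟨ cong (λ x → sumSel s B ⊕ lookup s i · (B i ⊕ x)) (replace-≡ B i C) ⟩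
  sumSel s B ⊕ lookup s i · (B i ⊕ C)
    ∎
  where
  open ≡-Reasoning
  B' = replace B i C
  agree-off-i : ∀ j → j ≢ i → B j ⊕ B' j ≡ ∅
  agree-off-i j j≢i = trans (cong (B j ⊕_) (replace-≢ B i C j≢i)) (⊕.inverseʳ (B j))

transvection : ∀ {k} → Fin k → Subset k → Subset k → Subset k
transvection i d s = s ⊕ lookup s i · d

transvection-involutive : ∀ {k} {i : Fin k} {d} → lookup d i ≡ false →
                          ∀ s → transvection i d (transvection i d s) ≡ s
transvection-involutive {i = i} {d} dᵢ≡false s = begin
  t ⊕ lookup t i · d                     ≡⟨ cong (λ b → t ⊕ b · d) tᵢ≡sᵢ ⟩
  (s ⊕ lookup s i · d) ⊕ lookup s i · d  ≡⟨ ⊕.[y⊕x]⊕x≡y (lookup s i · d) s ⟩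
  s                                      ∎
  where
  open ≡-Reasoning
  t = transvection i d s
  tᵢ≡sᵢ : lookup t i ≡ lookup s i
  tᵢ≡sᵢ = begin
    lookup t i
      ≡⟨ lookup-zipWith _xor_ i s (lookup s i · d) ⟩
    lookup s i xor lookup (lookup s i · d) i
      ≡⟨ cong (lookup s i xor_) (lookup-·-false (lookup s i) dᵢ≡false) ⟩
    lookup s i xor false
      ≡⟨ xor-identityʳ (lookup s i) ⟩
    lookup s i
      ∎

isBasis-via-involution : ∀ {G k} {B B' : Fin k → EdgeSet G} (φ : Subset k → Subset k) →
                         IsBasis G B → (∀ j → IsCycle G (B' j)) → (∀ s → φ (φ s) ≡ s) →
                         (∀ s → sumSel s B' ≡ sumSel (φ s) B) → IsBasis G B'
isBasis-via-involution {B = B} {B'} φ basis B'-cycles φ-involutive B'≈φB = record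
  { cycles = B'-cycles
  ; independent = λ s s↦∅ →
      let φs≡∅ = independent (φ s) (trans (sym (B'≈φB s)) s↦∅)
      in trans (sym (φ-involutive s)) (trans (cong φ φs≡∅) φ∅≡∅)
  ; spanning = λ C C-cycle →
      let t , t↦C = spanning C C-cycle
      in φ t , trans (B'≈φB (φ t)) (trans (cong (λ u → sumSel u B) (φ-involutive t)) t↦C)
  }
  where
  open IsBasis basis
  φ∅≡∅ : φ ∅ ≡ ∅
  φ∅≡∅ = independent (φ ∅) (trans (sym (B'≈φB ∅)) (sumSel-∅ B'))

replace-isBasis : ∀ {G k} {B : Fin k → EdgeSet G} {C E i} → IsBasis G B → IsCycle G C →
                  sumSel E B ≡ C → i ∈ E → IsBasis G (replace B i C)
replace-isBasis {G} {B = B} {C} {E} {i} basis C-cycle E↦C i∈E =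
  isBasis-via-involution (transvection i D) basis B'-cycles (transvection-involutive Dᵢ≡false) B'≈B
  where
  open IsBasis basis
  D = ⁅ i ⁆ ⊕ E

  Dᵢ≡false : lookup D i ≡ false
  Dᵢ≡false = trans (lookup-zipWith _xor_ i ⁅ i ⁆ E)
                   (cong₂ _xor_ ([]=⇒lookup (x∈⁅x⁆ i)) ([]=⇒lookup i∈E))

  B'-cycles : ∀ j → IsCycle G (replace B i C j)
  B'-cycles j with j F.≟ i
  ... | yes _ = C-cycle
  ... | no _ = cycles j

  D↦Bᵢ⊕C : sumSel D B ≡ B i ⊕ C
  D↦Bᵢ⊕C = trans (sumSel-⊕ ⁅ i ⁆ E B) (cong₂ _⊕_ (sumSel-⁅⁆ i B) E↦C)

  B'≈B : ∀ s → sumSel s (replace B i C) ≡ sumSel (transvection i D s) B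
  B'≈B s = begin
    sumSel s (replace B i C)
      ≡⟨ sumSel-replace s i B C ⟩
    sumSel s B ⊕ lookup s i · (B i ⊕ C)
      ≡⟨ cong (λ x → sumSel s B ⊕ lookup s i · x) D↦Bᵢ⊕C ⟨
    sumSel s B ⊕ lookup s i · sumSel D B
      ≡⟨ cong (sumSel s B ⊕_) (sumSel-· (lookup s i) D B) ⟨
    sumSel s B ⊕ sumSel (lookup s i · D) B
      ≡⟨ sumSel-⊕ s (lookup s i · D) B ⟨
    sumSel (transvection i D s) B
      ∎
    where open ≡-Reasoning

expansion-member-≤ : ∀ {G k} {M : Fin k → EdgeSet G} {C E i} → IsMCB G M → IsCycle G C →
                     sumSel E M ≡ C → i ∈ E → ∣ M i ∣ ≤ ∣ C ∣
expansion-member-≤ {M = M} {C} {i = i} (basis , minimal) C-cycle E↦C i∈E =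
  +-cancelˡ-≤ (weight M) (∣ M i ∣) (∣ C ∣) (begin
    weight M + ∣ M i ∣                ≤⟨ +-monoˡ-≤ ∣ M i ∣ (minimal _ _ exchanged-basis) ⟩
    weight (replace M i C) + ∣ M i ∣  ≡⟨ weight-replace M i C ⟩
    weight M + ∣ C ∣                  ∎)
  where
  open ≤-Reasoning
  exchanged-basis : IsBasis _ (replace M i C)
  exchanged-basis = replace-isBasis basis C-cycle E↦C i∈E

replace-isMCB : ∀ {G k} {M : Fin k → EdgeSet G} {C E i} → IsMCB G M → IsCycle G C →
                sumSel E M ≡ C → i ∈ E → ∣ M i ∣ ≡ ∣ C ∣ → IsMCB G (replace M i C)
replace-isMCB {M = M} {C} {i = i} (basis , minimal) C-cycle E↦C i∈E ∣Mᵢ∣≡∣C∣ =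
  replace-isBasis basis C-cycle E↦C i∈E ,
  λ k' B' B'-basis → ≤-trans (≤-reflexive same-weight) (minimal k' B' B'-basis)
  where
  same-weight : weight (replace M i C) ≡ weight M
  same-weight = +-cancelʳ-≡ ∣ M i ∣ _ _
    (trans (weight-replace M i C) (cong (weight M +_) (sym ∣Mᵢ∣≡∣C∣)))

relevant⇒expansion-member-≥ : ∀ {G k} {M : Fin k → EdgeSet G} {C E} →
                              IsBasis G M → sumSel E M ≡ C → IsRelevant G C →
                              ∃ λ j → j ∈ E × ∣ C ∣ ≤ ∣ M j ∣
relevant⇒expansion-member-≥ {M = M} {C} {E} M-basis E↦C (_ , M' , M'-mcb , i' , M'ᵢ'≡C) =
  j , j∈E , subst (λ X → ∣ X ∣ ≤ ∣ M j ∣) M'ᵢ'≡C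
                  (expansion-member-≤ M'-mcb (cycles j) (T↦M j) i'∈Tⱼ)
  where
  open IsBasis M-basis using (cycles)
  open IsBasis (proj₁ M'-mcb) using (spanning; independent)
  T = λ j → proj₁ (spanning (M j) (cycles j))
  T↦M = λ j → proj₂ (spanning (M j) (cycles j))
  S≡⁅i'⁆ : sumSel E T ≡ ⁅ i' ⁆
  S≡⁅i'⁆ = sumSel-injective independent (begin
    sumSel (sumSel E T) M'             ≡⟨ sumSel-sumSel E T M' ⟨
    sumSel E (λ j → sumSel (T j) M')   ≡⟨ sumSel-cong E T↦M ⟩
    sumSel E M                         ≡⟨ E↦C ⟩
    C                                  ≡⟨ M'ᵢ'≡C ⟨
    M' i'                              ≡⟨ sumSel-⁅⁆ i' M' ⟨
    sumSel ⁅ i' ⁆ M'                   ∎)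
    where open ≡-Reasoning
  found = ∈-sumSel⁻ E T (subst (i' ∈_) (sym S≡⁅i'⁆) (x∈⁅x⁆ i'))
  j = proj₁ found
  j∈E = proj₁ (proj₂ found)
  i'∈Tⱼ = proj₂ (proj₂ found)

maxSel-lub : ∀ {m k} (E : Subset k) (M : Fin k → Subset m) {x} →
             (∀ {j} → j ∈ E → ∣ M j ∣ ≤ x) → maxSel E M ≤ x
maxSel-lub [] M bound = z≤n
maxSel-lub (true ∷ E) M bound = ⊔-lub (bound here) (maxSel-lub E (M ∘ suc) (bound ∘ there))
maxSel-lub (false ∷ E) M bound = maxSel-lub E (M ∘ suc) (bound ∘ there)

maxSel-ub : ∀ {m k} (E : Subset k) (M : Fin k → Subset m) {j} → j ∈ E → ∣ M j ∣ ≤ maxSel E M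
maxSel-ub (true ∷ E) M here = m≤m⊔n _ _
maxSel-ub (b ∷ E) M (there j∈E) = ≤-trans (maxSel-ub E (M ∘ suc) j∈E) (m≤n⊔m _ _)

maxSel-attained : ∀ {m k} (E : Subset k) (M : Fin k → Subset m) → maxSel E M ≢ 0 →
                  ∃ λ j → j ∈ E × ∣ M j ∣ ≡ maxSel E M
maxSel-attained [] M L≢0 = ⊥-elim (L≢0 refl)
maxSel-attained (true ∷ E) M L≢0 with ⊔-sel ∣ M zero ∣ (maxSel E (M ∘ suc))
... | inj₁ L≡∣M₀∣ = zero , here , sym L≡∣M₀∣
... | inj₂ L≡tail =
  let j , j∈E , ∣Mⱼ∣≡tail = maxSel-attained E (M ∘ suc) (L≢0 ∘ trans L≡tail)
  in suc j , there j∈E , trans ∣Mⱼ∣≡tail (sym L≡tail)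
maxSel-attained (false ∷ E) M L≢0 =
  let j , j∈E , ∣Mⱼ∣≡L = maxSel-attained E (M ∘ suc) L≢0
  in suc j , there j∈E , ∣Mⱼ∣≡L

lemma4 : (G : Graph) (C : EdgeSet G) → IsCycle G C → C ≢ ∅ →
    (k : ℕ) (M : Fin k → EdgeSet G) → IsMCB G M →
    (E : Subset k) → sumSel E M ≡ C →
    (maxSel E M ≤ ∣ C ∣)
    × (maxSel E M ≡ ∣ C ∣ ⇔ IsRelevant G C)
    × (IsRelevant G C → (i : Fin k) → i ∈ E → ∣ M i ∣ ≡ ∣ C ∣ →
        IsMCB G (replace M i C))
lemma4 G C C-cycle C≢∅ k M M-mcb E E↦C =
  L≤∣C∣ , mk⇔ L≡∣C∣⇒relevant relevant⇒L≡∣C∣ , exchange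
  where
  L≤∣C∣ : maxSel E M ≤ ∣ C ∣
  L≤∣C∣ = maxSel-lub E M (expansion-member-≤ M-mcb C-cycle E↦C)

  L≡∣C∣⇒relevant : maxSel E M ≡ ∣ C ∣ → IsRelevant G C
  L≡∣C∣⇒relevant L≡∣C∣ =
    let j , j∈E , ∣Mⱼ∣≡L = maxSel-attained E M L≢0
    in k , replace M j C , replace-isMCB M-mcb C-cycle E↦C j∈E (trans ∣Mⱼ∣≡L L≡∣C∣) ,
       j , replace-≡ M j C
    where
    L≢0 : maxSel E M ≢ 0
    L≢0 = C≢∅ ∘ ∣p∣≡0⇒p≡∅ C ∘ trans (sym L≡∣C∣)

  relevant⇒L≡∣C∣ : IsRelevant G C → maxSel E M ≡ ∣ C ∣
  relevant⇒L≡∣C∣ C-relevant =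
    let j , j∈E , ∣C∣≤∣Mⱼ∣ = relevant⇒expansion-member-≥ (proj₁ M-mcb) E↦C C-relevant
    in ≤-antisym L≤∣C∣ (≤-trans ∣C∣≤∣Mⱼ∣ (maxSel-ub E M j∈E))

  exchange : IsRelevant G C → (i : Fin k) → i ∈ E → ∣ M i ∣ ≡ ∣ C ∣ → IsMCB G (replace M i C)
  exchange _ i i∈E = replace-isMCB M-mcb C-cycle E↦C i∈E
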